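{- Let $f:\mathbb{Z}\to\mathbb{Z}$ be a non-decreasing congruence preserving function (for all $a,b\in\mathbb{Z}$, $a-b$ divides $f(a)-f(b)$). Then for every set $L\subseteq\mathbb{Z}$, $$f^{ -1}(L)=\bigcup_{a\in f^{ -1}(L)}\ \bigcap_{t\in L-a}(L-t).$$
   Context: For $L\subseteq\mathbb{Z}$ and $t\in\mathbb{Z}$, $L-t=\{x-t\mid x\in L\}$. -}

module Defs where

open import Level using (0ℓ)
open import Data.Integer using (ℤ; _-_; _≤_)
open import Data.Integer.Divisibility using (_∣_)
open import Data.Product using (Σ; _×_)
open import Relation.Unary using (Pred; _∈_)
open import Relation.Binary.PropositionalEquality using (_≡_)

_-ˢ_ : Pred ℤ 0ℓ → ℤ → Pred ℤ 0ℓ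
(L -ˢ t) z = Σ ℤ (λ x → x ∈ L × z ≡ x - t)

_⁻¹[_] : (ℤ → ℤ) → Pred ℤ 0ℓ → Pred ℤ 0ℓ
(f ⁻¹[ L ]) a = f a ∈ L

NonDecreasing : (ℤ → ℤ) → Set
NonDecreasing f = ∀ a b → a ≤ b → f a ≤ f b

CongruencePreserving : (ℤ → ℤ) → Set
CongruencePreserving f = ∀ a b → (a - b) ∣ (f a - f b)

module Submission where

-- ⊆ : a point x of f⁻¹(L) lies in the part indexed by a = x, since every
--     t = y - x with y ∈ L gives x = y - t ∈ L - t.
-- ⊇ : if f a ∈ L and x lies in every L - t with t ∈ L - a, then L is closed
--     under adding d = x - a (take t = y - a for y ∈ L), hence under adding
--     any n·d with n ∈ ℕ.  Congruence preservation gives f x - f a = q·d, and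
--     monotonicity forces f x - f a and d to have the same sign, so the
--     quotient may be taken non-negative (a non-positive quotient forces
--     f x = f a).  Therefore f x = f a + n·d ∈ L.

open import Defs
open import Level using (0ℓ)
open import Data.Integer using (ℤ; +_; -[1+_]; _+_; _-_; _*_; _≤_; 0ℤ; 1ℤ; NonPositive)
open import Data.Integer.Properties
  using (≤-total; ≤-antisym; *-zeroʳ; *-monoˡ-≤-nonPos;
         i≤j⇒0≤j-i; i≤j⇒i-j≤0; 0≤i-j⇒j≤i; i-j≤0⇒i≤j)
open import Data.Integer.Divisibility.Signed using (divides; ∣ᵤ⇒∣)
open import Data.Integer.Tactic.RingSolver using (solve-∀)
open import Data.Nat using (ℕ; zero; suc)
open import Data.Product using (Σ; _,_)
open import Data.Sum using (inj₁; inj₂)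
open import Relation.Unary using (Pred; _∈_; _≐_; _⊆_; ⋃; ⋂)
open import Relation.Binary.PropositionalEquality using (_≡_; refl; sym; subst)

iterate-closed : ∀ {ℓ} (L : Pred ℤ ℓ) (d : ℤ) → (∀ {y} → y ∈ L → y + d ∈ L) →
                 ∀ {b} → b ∈ L → (n : ℕ) → b + + n * d ∈ L
iterate-closed L d step {b} b∈L zero = subst (_∈ L) (sym (b+0≡b b)) b∈L
  where
  b+0≡b : ∀ b → b + 0ℤ * d ≡ b
  b+0≡b = solve-∀
iterate-closed L d step {b} b∈L (suc n) =
  subst (_∈ L) (unfold b d (+ n)) (step (iterate-closed L d step b∈L n))
  where
  -- + suc n is definitionally 1ℤ + + n
  unfold : ∀ b d m → b + m * d + d ≡ b + (1ℤ + m) * d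
  unfold = solve-∀

nonPos-multiple-of-same-sign : ∀ q d e → .{{_ : NonPositive q}} → e ≡ q * d →
                               (0ℤ ≤ d → 0ℤ ≤ e) → (d ≤ 0ℤ → e ≤ 0ℤ) → e ≡ 0ℤ
nonPos-multiple-of-same-sign q d e refl same-sign₊ same-sign₋ with ≤-total 0ℤ d
... | inj₁ 0≤d = ≤-antisym (subst (q * d ≤_) (*-zeroʳ q) (*-monoˡ-≤-nonPos q 0≤d))
                           (same-sign₊ 0≤d)
... | inj₂ d≤0 = ≤-antisym (same-sign₋ d≤0)
                           (subst (_≤ q * d) (*-zeroʳ q) (*-monoˡ-≤-nonPos q d≤0))

nonneg-quotient : (f : ℤ → ℤ) → NonDecreasing f → CongruencePreserving f →
                  ∀ x a → Σ ℕ (λ n → f x - f a ≡ + n * (x - a))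
nonneg-quotient f mono cp x a with ∣ᵤ⇒∣ (cp x a)
... | divides (+ n) eq = n , eq
... | divides q@(-[1+ _ ]) eq =
  0 , nonPos-multiple-of-same-sign q (x - a) (f x - f a) eq
        (λ 0≤d → i≤j⇒0≤j-i (mono a x (0≤i-j⇒j≤i 0≤d)))
        (λ d≤0 → i≤j⇒i-j≤0 (mono x a (i-j≤0⇒i≤j d≤0)))

difference⇒sum : ∀ {u v e} → u - v ≡ e → u ≡ v + e
difference⇒sum {u} {v} refl = u≡v+[u-v] u v
  where
  u≡v+[u-v] : ∀ u v → u ≡ v + (u - v)
  u≡v+[u-v] = solve-∀

Stable : Pred ℤ 0ℓ → ℤ → Pred ℤ 0ℓ
Stable L a = ⋂ (Σ ℤ (λ t → t ∈ (L -ˢ a))) (λ t → L -ˢ Σ.proj₁ t)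

-- Every point x belongs to its own part: t = y - x gives x = y - t.
self-stable : (L : Pred ℤ 0ℓ) (x : ℤ) → x ∈ Stable L x
self-stable L x (t , y , y∈L , refl) = y , y∈L , x≡y-[y-x] x y
  where
  x≡y-[y-x] : ∀ x y → x ≡ y - (y - x)
  x≡y-[y-x] = solve-∀

-- If x ∈ Stable L a then L is closed under adding x - a: for y ∈ L,
-- x ∈ L - (y - a) yields z ∈ L with z = y + (x - a).
stable-step : (L : Pred ℤ 0ℓ) (a x : ℤ) → x ∈ Stable L a →
              ∀ {y} → y ∈ L → y + (x - a) ∈ L
stable-step L a x x∈S {y} y∈L with x∈S (y - a , y , y∈L , refl)
... | z , z∈L , refl = subst (_∈ L) (z≡y+[z-[y-a]-a] z y a) z∈L
  where
  z≡y+[z-[y-a]-a] : ∀ z y a → z ≡ y + (z - (y - a) - a)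
  z≡y+[z-[y-a]-a] = solve-∀

lemma31 : (f : ℤ → ℤ) → NonDecreasing f → CongruencePreserving f →
          (L : Pred ℤ 0ℓ) →
          (f ⁻¹[ L ]) ≐ ⋃ (Σ ℤ (λ a → a ∈ (f ⁻¹[ L ])))
                          (λ a → ⋂ (Σ ℤ (λ t → t ∈ (L -ˢ Σ.proj₁ a)))
                                    (λ t → L -ˢ Σ.proj₁ t))
lemma31 f mono cp L = (λ {x} fx∈L → (x , fx∈L) , self-stable L x) , ⊇
  where
  ⊇ : ⋃ (Σ ℤ (λ a → a ∈ (f ⁻¹[ L ]))) (λ a → Stable L (Σ.proj₁ a)) ⊆ f ⁻¹[ L ]
  ⊇ {x} ((a , fa∈L) , x∈S) with nonneg-quotient f mono cp x a
  ... | n , fx-fa≡n*d = subst (_∈ L) (sym (difference⇒sum fx-fa≡n*d))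
                          (iterate-closed L (x - a) (stable-step L a x x∈S) fa∈L n)
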